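{- Let $X_1\to Y_1,\ldots,X_k\to Y_k$ be partial implications on $[n]$ and let $U=X_1Y_1\cdots X_kY_k$. The following are equivalent: 1. $X_1\to Y_1,\ldots,X_k\to Y_k$ enforces homogeneity; 2. for every $i\in[k]$, the classical implications $X_1\Rightarrow Y_1,\ldots,X_k\Rightarrow Y_k$ classically entail $X_i\Rightarrow U$, i.e. every $Z\subseteq[n]$ satisfying all $X_j\Rightarrow Y_j$ ($j\in[k]$) satisfies $X_i\Rightarrow U$.
   Context: A partial implication $X\to Y$ is a pair of subsets of $[n]$; juxtaposition of sets denotes union. Its classical counterpart is $X\Rightarrow Y$; a set $Z\subseteq[n]$ satisfies $X\Rightarrow Y$ (written $Z\models X\Rightarrow Y$) if $X\not\subseteq Z$ or $XY\subseteq Z$. A set $X_1\to Y_1,\ldots,X_k\to Y_k$ enforces homogeneity if for every $Z\subseteq[n]$: if for all $i\in[k]$ either $X_i\not\subseteq Z$ or $X_iY_i\subseteq Z$, then either $X_i\not\subseteq Z$ for all $i\in[k]$, or $X_iY_i\subseteq Z$ for all $i\in[k]$. -}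

module Defs where

open import Data.Nat using (ℕ)
open import Data.Fin using (Fin)
open import Data.Fin.Subset using (Subset; _⊆_; _∪_; ⊥)
open import Data.Product using (_×_; proj₁; proj₂)
open import Data.Sum using (_⊎_)
open import Data.List using (List; foldr; allFin; map)
open import Relation.Nullary using (¬_)
open import Function using (_⇔_)

PartialImpl : ℕ → Set
PartialImpl n = Subset n × Subset n

premise : ∀ {n} → PartialImpl n → Subset n
premise = proj₁

conclusion : ∀ {n} → PartialImpl n → Subset n
conclusion = proj₂

_⊨_⇒_ : ∀ {n} → Subset n → Subset n → Subset n → Set
Z ⊨ X ⇒ Y = (¬ (X ⊆ Z)) ⊎ ((X ∪ Y) ⊆ Z)

Family : ℕ → ℕ → Set
Family k n = Fin k → PartialImpl n

SatAll : ∀ {k n} → Family k n → Subset n → Set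
SatAll {k} F Z = ∀ (i : Fin k) → Z ⊨ premise (F i) ⇒ conclusion (F i)

EnforcesHomogeneity : ∀ {k n} → Family k n → Set
EnforcesHomogeneity {k} {n} F =
  ∀ (Z : Subset n) → SatAll F Z →
    (∀ (i : Fin k) → ¬ (premise (F i) ⊆ Z))
    ⊎ (∀ (i : Fin k) → (premise (F i) ∪ conclusion (F i)) ⊆ Z)

unionAll : ∀ {k n} → Family k n → Subset n
unionAll {k} F = foldr _∪_ ⊥ (map (λ i → premise (F i) ∪ conclusion (F i)) (allFin k))

EntailsAllToU : ∀ {k n} → Family k n → Set
EntailsAllToU {k} {n} F =
  ∀ (i : Fin k) (Z : Subset n) → SatAll F Z → Z ⊨ premise (F i) ⇒ unionAll F

module Submission where

-- Call  block i = X_i Y_i,  so that  U  is the union of all blocks.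
-- For a set Z, "X_i ⇒ U holds in Z" amounts to: if X_i ⊆ Z then U ⊆ Z (since
-- X_i ⊆ U), and U ⊆ Z holds exactly when every block lies in Z.
--
--  (1 ⇒ 2)  Let Z satisfy all X_j ⇒ Y_j with X_i ⊆ Z.  Homogeneity cannot take
--           the "no premise in Z" branch (X_i is one), so every block lies in Z,
--           hence U ⊆ Z and X_i U ⊆ Z.
--  (2 ⇒ 1)  Given Z satisfying all X_j ⇒ Y_j, decide whether some premise X_i
--           lies in Z.  If none does, Z is in the first homogeneous case.  If X_i
--           does, the entailed X_i ⇒ U fires in Z, so U ⊆ Z and every block lies in Z.

open import Data.Nat using (ℕ)
open import Data.Fin using (Fin)
open import Data.Fin.Subset using (Subset; _⊆_; _∪_; ⋃)
open import Data.Fin.Subset.Properties using (_⊆?_; p⊆p∪q; q⊆p∪q; x∈p∪q⁻; ∉⊥)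
open import Data.Fin.Properties using (any?)
open import Data.List using (List; []; _∷_; map; allFin)
open import Data.List.Relation.Unary.Any using (here; there)
import Data.List.Membership.Propositional as List
open import Data.List.Membership.Propositional.Properties using (∈-map⁺; ∈-map⁻; ∈-allFin)
open import Data.Product using (_,_)
open import Data.Sum using (inj₁; inj₂)
open import Data.Empty using (⊥-elim)
open import Function using (_⇔_; mk⇔; _∘_)
open import Relation.Nullary using (yes; no)
open import Relation.Binary.PropositionalEquality using (refl)
open import Defs

module _ {n : ℕ} where

  ∪-least : ∀ {A B Z : Subset n} → A ⊆ Z → B ⊆ Z → A ∪ B ⊆ Z
  ∪-least {A} {B} A⊆Z B⊆Z x∈A∪B with x∈p∪q⁻ A B x∈A∪B
  ... | inj₁ x∈A = A⊆Z x∈A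
  ... | inj₂ x∈B = B⊆Z x∈B

  ⋃-least : ∀ (As : List (Subset n)) {Z : Subset n} →
            (∀ {A} → A List.∈ As → A ⊆ Z) → ⋃ As ⊆ Z
  ⋃-least []       _    x∈⊥ = ⊥-elim (∉⊥ x∈⊥)
  ⋃-least (A ∷ As) As⊆Z = ∪-least (As⊆Z (here refl)) (⋃-least As (As⊆Z ∘ there))

  ⋃-upper : ∀ (As : List (Subset n)) {A : Subset n} → A List.∈ As → A ⊆ ⋃ As
  ⋃-upper (B ∷ As) (here refl) = p⊆p∪q (⋃ As)
  ⋃-upper (B ∷ As) (there A∈As) = q⊆p∪q B (⋃ As) ∘ ⋃-upper As A∈As

  ⊨-fire : ∀ {X Y Z : Subset n} → Z ⊨ X ⇒ Y → X ⊆ Z → X ∪ Y ⊆ Z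
  ⊨-fire (inj₁ X⊈Z) X⊆Z = ⊥-elim (X⊈Z X⊆Z)
  ⊨-fire (inj₂ XY⊆Z) _  = XY⊆Z

module _ {k n : ℕ} (F : Family k n) where

  block : Fin k → Subset n
  block i = premise (F i) ∪ conclusion (F i)

  blocks : List (Subset n)
  blocks = map block (allFin k)

  block⊆U : ∀ i → block i ⊆ unionAll F
  block⊆U i = ⋃-upper blocks (∈-map⁺ block (∈-allFin i))

  U-least : ∀ {Z} → (∀ i → block i ⊆ Z) → unionAll F ⊆ Z
  U-least {Z} blocks⊆Z = ⋃-least blocks member⊆Z
    where
    member⊆Z : ∀ {A} → A List.∈ blocks → A ⊆ Z
    member⊆Z A∈blocks with ∈-map⁻ block A∈blocks
    ... | i , _ , refl = blocks⊆Z i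

  -- (1 ⇒ 2): a premise inside Z rules out the first homogeneous case.
  homogeneity⇒entailment : EnforcesHomogeneity F → EntailsAllToU F
  homogeneity⇒entailment homogeneous i Z satZ with premise (F i) ⊆? Z
  ... | no  Xᵢ⊈Z = inj₁ Xᵢ⊈Z
  ... | yes Xᵢ⊆Z with homogeneous Z satZ
  ...   | inj₁ noPremise = ⊥-elim (noPremise i Xᵢ⊆Z)
  ...   | inj₂ allBlocks = inj₂ (∪-least Xᵢ⊆Z (U-least allBlocks))

  -- (2 ⇒ 1): a premise X_i inside Z fires X_i ⇒ U, putting every block in Z.
  entailment⇒homogeneity : EntailsAllToU F → EnforcesHomogeneity F
  entailment⇒homogeneity entails Z satZ with any? (λ i → premise (F i) ⊆? Z)
  ... | no  noPremise  = inj₁ (λ i Xᵢ⊆Z → noPremise (i , Xᵢ⊆Z))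
  ... | yes (i , Xᵢ⊆Z) = inj₂ (λ j → U⊆Z ∘ block⊆U j)
    where
    U⊆Z : unionAll F ⊆ Z
    U⊆Z = ⊨-fire (entails i Z satZ) Xᵢ⊆Z ∘ q⊆p∪q (premise (F i)) (unionAll F)

lemma4 : ∀ (k n : ℕ) (F : Family k n) →
    EnforcesHomogeneity F ⇔ EntailsAllToU F
lemma4 k n F = mk⇔ (homogeneity⇒entailment F) (entailment⇒homogeneity F)
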